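{- Let $P,Q\in\mathbb{Z}$ with $PQ=0$ and let $R\in\mathbb{Q}\setminus\mathbb{Z}$. Then $\mathcal{L}(P,Q,R)$ is one of the following: (1) $\{0\}$; (2) $S_m=\{0,m,m+1,m+2,\ldots\}$ for some $m\geq 2$; (3) $\langle 2\rangle$; (4) $\langle 2,m\rangle$ for some odd $m\geq 3$. Moreover, each semigroup in this list arises as $\mathcal{L}(P,Q,R)$ for some $P,Q\in\mathbb{Z}$ with $PQ=0$ and some $R\in\mathbb{Q}\setminus\mathbb{Z}$, and each is dimension-$2$ realizable.
   Context: $\mathbb{N}=\{0,1,2,\ldots\}$. For $P,Q\in\mathbb{Z}$, the Lucas sequence $U_n=U_n(P,Q)$ is defined by $U_0=0$, $U_1=1$, $U_{n+2}=PU_{n+1}-QU_n$. For $R\in\mathbb{Q}$, $\mathcal{L}(P,Q,R)=\{n\in\mathbb{N} : U_nR\in\mathbb{Z}\}$. $\langle\cdot\rangle$ denotes the additive subsemigroup of $\mathbb{N}$ generated by the given elements. For $A\in\mathrm{M}_d(\mathbb{Q})$, its exponent semigroup is $\mathcal{S}(A)=\{n\in\mathbb{N}: A^n\in\mathrm{M}_d(\mathbb{Z})\}$. A semigroup $S\subseteq\mathbb{N}$ is dimension-$d$ realizable if $S=\mathcal{S}(A)$ for some $A\in\mathrm{M}_d(\mathbb{Q})$. -}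

module Defs where

open import Data.Nat as ℕ using (ℕ; zero; suc)
open import Data.Integer as ℤ using (ℤ; +_)
open import Data.Rational as ℚ using (ℚ; _/_; 0ℚ; 1ℚ)
open import Data.Fin using (Fin; zero; suc)
open import Data.List using (List)
open import Data.List.Membership.Propositional using (_∈_)
open import Data.Product using (Σ; _×_)
open import Relation.Binary.PropositionalEquality using (_≡_)
open import Function.Bundles using (_⇔_)

SubsetN : Set₁
SubsetN = ℕ → Set

_≐_ : SubsetN → SubsetN → Set
S ≐ T = ∀ n → S n ⇔ T n

U : ℤ → ℤ → ℕ → ℤ
U P Q zero = + 0
U P Q (suc zero) = + 1
U P Q (suc (suc n)) = P ℤ.* U P Q (suc n) ℤ.- Q ℤ.* U P Q n

IsInt : ℚ → Set
IsInt q = Σ ℤ λ z → z / 1 ≡ q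

𝓛 : ℤ → ℤ → ℚ → SubsetN
𝓛 P Q R n = IsInt ((U P Q n / 1) ℚ.* R)

data ⟨_⟩ (gs : List ℕ) : SubsetN where
  gen-zero : ⟨ gs ⟩ 0
  gen-add  : ∀ {g n} → g ∈ gs → ⟨ gs ⟩ n → ⟨ gs ⟩ (g ℕ.+ n)

Zero : SubsetN
Zero n = n ≡ 0

Sₘ : ℕ → SubsetN
Sₘ m n = (n ≡ 0) Data.Sum.⊎ (m ℕ.≤ n)
  where import Data.Sum

Odd : ℕ → Set
Odd m = Σ ℕ λ k → m ≡ suc (2 ℕ.* k)

Mat : ℕ → Set
Mat d = Fin d → Fin d → ℚ

sumFin : ∀ d → (Fin d → ℚ) → ℚ
sumFin zero f = 0ℚ
sumFin (suc d) f = f zero ℚ.+ sumFin d (λ i → f (suc i))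

idMat : ∀ d → Mat d
idMat (suc d) zero zero = 1ℚ
idMat (suc d) zero (suc j) = 0ℚ
idMat (suc d) (suc i) zero = 0ℚ
idMat (suc d) (suc i) (suc j) = idMat d i j

_⊛_ : ∀ {d} → Mat d → Mat d → Mat d
_⊛_ {d} A B i j = sumFin d (λ k → A i k ℚ.* B k j)

_^ᴹ_ : ∀ {d} → Mat d → ℕ → Mat d
_^ᴹ_ {d} A zero = idMat d
A ^ᴹ suc n = A ⊛ (A ^ᴹ n)

IsIntMat : ∀ {d} → Mat d → Set
IsIntMat A = ∀ i j → IsInt (A i j)

𝓢 : ∀ {d} → Mat d → SubsetN
𝓢 A n = IsIntMat (A ^ᴹ n)

Realizable : ℕ → SubsetN → Set
Realizable d S = Σ (Mat d) λ A → 𝓢 A ≐ S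

InList : SubsetN → Set
InList S =
  (S ≐ Zero) ⊎
  (Σ ℕ λ m → 2 ℕ.≤ m × S ≐ Sₘ m) ⊎
  (S ≐ ⟨ 2 ∷ [] ⟩) ⊎
  (Σ ℕ λ m → Odd m × 3 ℕ.≤ m × S ≐ ⟨ 2 ∷ m ∷ [] ⟩)
  where
  open import Data.Sum using (_⊎_)
  open import Data.List using (_∷_; [])

module Submission where

-- Let b be the reduced denominator of R, so that U_n R ∈ ℤ iff b ∣ U_n. If Q = 0 then
-- U_(k+1) = P^k, and if P = 0 then U_(2j) = 0 and U_(2j+1) = (−Q)^j. For c = P resp. Q the
-- exponents k with b ∣ c^k form an upward closed set, and whether it is empty is decidable:
-- dividing b by gcd(b, c) costs exactly one factor c and strictly decreases b unless b is
-- coprime to c. So the set is empty or a ray [k₀, ∞), with k₀ ≥ 1 since b ∤ 1, which yields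
-- {0}, S_(k₀+1), ⟨2⟩ and ⟨2, 2k₀+1⟩. Conversely R = 1/2 or 1/2^k₀ with P or Q in {1, 2}
-- realizes each shape, and the matrices A = [[P, R], [0, 0]] with A² = P A and, for R = 1/b,
-- A = [[0, R], [−Q b, 0]] with A² = −Q I have powers P^k A, resp. (−Q)^j I and (−Q)^j A,
-- so their exponent semigroups are exactly these sets 𝓛.

open import Defs
open import Data.Integer using (ℤ; _*_; +_)
open import Data.Rational using (ℚ)
open import Data.Product using (Σ; _×_)
open import Relation.Binary.PropositionalEquality using (_≡_)
open import Relation.Nullary using (¬_)

open import Data.Empty using (⊥-elim)
open import Data.Fin using (Fin; zero; suc)
open import Data.Integer as ℤ using (-_; 1ℤ)
import Data.Integer.Properties as ℤₚ
import Data.Integer.Divisibility.Signed as ℤ∣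
open import Data.List using ([]; _∷_)
open import Data.List.Membership.Propositional using (_∈_)
open import Data.List.Relation.Unary.Any using (here; there)
open import Data.Nat as ℕ using (ℕ; zero; suc; _≤_; _<_; z≤n; s≤s; NonZero; _^_; _≤?_; _≟_)
import Data.Nat.Properties as ℕₚ
open import Data.Nat.Divisibility
open import Data.Nat.DivMod using (_/_; m/n<m; m/n*n≡m)
open import Data.Nat.GCD using (gcd; gcd[m,n]∣m; gcd[m,n]∣n; gcd[m,n]≢0; m/gcd[m,n]≢0)
open import Data.Nat.Coprimality as Coprime
  using (Coprime; coprime-divisor; coprime-/gcd; gcd≡1⇒coprime; 1-coprimeTo)
open import Data.Nat.Induction using (<-wellFounded)
open import Data.Product using (_,_; ∃-syntax)
open import Data.Rational as ℚ using (mkℚ; ↥_; ↧_; ↧ₙ_; toℚᵘ; 0ℚ; 1ℚ)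
import Data.Rational.Properties as ℚₚ
open import Data.Rational.Solver using (module +-*-Solver)
open import Data.Rational.Unnormalised using (mkℚᵘ; *≡*) renaming (_≃_ to _≃ᵘ_)
import Data.Rational.Unnormalised.Properties as ℚᵘₚ
open import Data.Sum using (_⊎_; inj₁; inj₂)
open import Data.Unit using (⊤; tt)
open import Function using (_∘_)
open import Function.Bundles using (_⇔_; mk⇔; Equivalence)
open import Function.Properties.Equivalence using ()
  renaming (refl to ⇔-refl; sym to ⇔-sym; trans to ⇔-trans)
open import Induction.WellFounded using (Acc; acc)
open import Relation.Binary.PropositionalEquality
  using (_≢_; refl; sym; trans; cong; cong₂; subst; module ≡-Reasoning)
open import Relation.Nullary using (Dec; yes; no; contradiction)
open import Relation.Nullary.Decidable using (map′)
open import Relation.Unary using (Decidable)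
open import Algebra.Bundles using (CommutativeMonoid)
import Algebra.Properties.CommutativeSemigroup as CommSemigroupProperties

open Equivalence using (to; from)
open CommSemigroupProperties ℤₚ.*-commutativeSemigroup using (xy∙z≈xz∙y)
open CommSemigroupProperties (CommutativeMonoid.commutativeSemigroup ℚₚ.*-1-commutativeMonoid)
  using (x∙yz≈y∙xz)

≐-sym : ∀ {S T} → S ≐ T → T ≐ S
≐-sym S≐T n = ⇔-sym (S≐T n)

≐-trans : ∀ {S T V} → S ≐ T → T ≐ V → S ≐ V
≐-trans S≐T T≐V n = ⇔-trans (S≐T n) (T≐V n)

fromℤ : ℤ → ℚ
fromℤ z = z ℚ./ 1

toℚᵘ-fromℤ : ∀ z → toℚᵘ (fromℤ z) ≃ᵘ mkℚᵘ z 0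
toℚᵘ-fromℤ z = ℚₚ.toℚᵘ-fromℚᵘ (mkℚᵘ z 0)

toℚᵘ-fromℤ* : ∀ z R → toℚᵘ (fromℤ z ℚ.* R) ≃ᵘ mkℚᵘ (z * ↥ R) (ℚ.denominator-1 R)
toℚᵘ-fromℤ* z R@(mkℚ n d _) = ℚᵘₚ.≃-trans (ℚₚ.toℚᵘ-homo-* (fromℤ z) R)
  (ℚᵘₚ.≃-trans (ℚᵘₚ.*-congʳ (toℚᵘ-fromℤ z))
    (*≡* (cong (λ m → z * n * + suc m) (sym (ℕₚ.+-identityʳ d)))))

fromℤ≡fromℤ*⇔ : ∀ w z R → fromℤ w ≡ fromℤ z ℚ.* R ⇔ w * ↧ R ≡ z * ↥ R
fromℤ≡fromℤ*⇔ w z R = mk⇔ to′ from′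
  where
  to′ : fromℤ w ≡ fromℤ z ℚ.* R → w * ↧ R ≡ z * ↥ R
  to′ e with ℚᵘₚ.≃-trans (ℚᵘₚ.≃-sym (toℚᵘ-fromℤ w)) (ℚᵘₚ.≃-trans (ℚₚ.toℚᵘ-cong e) (toℚᵘ-fromℤ* z R))
  ... | *≡* eq = trans eq (ℤₚ.*-identityʳ (z * ↥ R))
  from′ : w * ↧ R ≡ z * ↥ R → fromℤ w ≡ fromℤ z ℚ.* R
  from′ eq = ℚₚ.toℚᵘ-injective (ℚᵘₚ.≃-trans (toℚᵘ-fromℤ w)
    (ℚᵘₚ.≃-trans (*≡* (trans eq (sym (ℤₚ.*-identityʳ (z * ↥ R))))) (ℚᵘₚ.≃-sym (toℚᵘ-fromℤ* z R))))

fromℤ-* : ∀ a b → fromℤ (a * b) ≡ fromℤ a ℚ.* fromℤ b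
fromℤ-* a b = ℚₚ.toℚᵘ-injective (ℚᵘₚ.≃-trans (toℚᵘ-fromℤ (a * b))
  (ℚᵘₚ.≃-sym (ℚᵘₚ.≃-trans (ℚₚ.toℚᵘ-homo-* (fromℤ a) (fromℤ b))
    (ℚᵘₚ.*-cong (toℚᵘ-fromℤ a) (toℚᵘ-fromℤ b)))))

fromℤ-*-assoc : ∀ a b x → fromℤ a ℚ.* (fromℤ b ℚ.* x) ≡ fromℤ (a * b) ℚ.* x
fromℤ-*-assoc a b x = trans (sym (ℚₚ.*-assoc (fromℤ a) (fromℤ b) x)) (cong (ℚ._* x) (sym (fromℤ-* a b)))

IsInt-fromℤ : ∀ z → IsInt (fromℤ z)
IsInt-fromℤ z = z , refl

IsInt-fromℤ* : ∀ z {q} → IsInt q → IsInt (fromℤ z ℚ.* q)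
IsInt-fromℤ* z (w , refl) = z * w , fromℤ-* z w

IsInt-fromℤ*⇔ : ∀ z R → IsInt (fromℤ z ℚ.* R) ⇔ ↧ₙ R ∣ ℤ.∣ z ∣
IsInt-fromℤ*⇔ z R@(mkℚ _ _ coprime) = mk⇔ to′ from′
  where
  to′ : IsInt (fromℤ z ℚ.* R) → ↧ₙ R ∣ ℤ.∣ z ∣
  to′ (w , e) = coprime-divisor (Coprime.sym (Coprime.recompute coprime))
    (divides ℤ.∣ w ∣ (begin
      ℤ.∣ ↥ R ∣ ℕ.* ℤ.∣ z ∣ ≡⟨ ℕₚ.*-comm ℤ.∣ ↥ R ∣ ℤ.∣ z ∣ ⟩
      ℤ.∣ z ∣ ℕ.* ℤ.∣ ↥ R ∣ ≡⟨ sym (ℤₚ.abs-* z (↥ R)) ⟩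
      ℤ.∣ z * ↥ R ∣       ≡⟨ cong ℤ.∣_∣ (sym (to (fromℤ≡fromℤ*⇔ w z R) e)) ⟩
      ℤ.∣ w * ↧ R ∣       ≡⟨ ℤₚ.abs-* w (↧ R) ⟩
      ℤ.∣ w ∣ ℕ.* ↧ₙ R    ∎))
    where open ≡-Reasoning
  from′ : ↧ₙ R ∣ ℤ.∣ z ∣ → IsInt (fromℤ z ℚ.* R)
  from′ ↧R∣z with ℤ∣.∣ᵤ⇒∣ {↧ R} {z} ↧R∣z
  ... | ℤ∣.divides q refl =
    q * ↥ R , from (fromℤ≡fromℤ*⇔ (q * ↥ R) (q * ↧ R) R) (xy∙z≈xz∙y q (↥ R) (↧ R))

IsInt⇔↧∣1 : ∀ R → IsInt R ⇔ ↧ₙ R ∣ 1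
IsInt⇔↧∣1 R = subst (λ q → IsInt q ⇔ ↧ₙ R ∣ 1) (ℚₚ.*-identityˡ R) (IsInt-fromℤ*⇔ 1ℤ R)

1/_ : (b : ℕ) → .{{NonZero b}} → ℚ
1/ suc d = mkℚ (+ 1) d (1-coprimeTo (suc d))

↧ₙ-1/ : ∀ b .{{_ : NonZero b}} → ↧ₙ (1/ b) ≡ b
↧ₙ-1/ (suc d) = refl

1/-*-fromℤ : ∀ b .{{_ : NonZero b}} z → 1/ b ℚ.* fromℤ (z * + b) ≡ fromℤ z
1/-*-fromℤ b@(suc _) z = trans (ℚₚ.*-comm (1/ b) (fromℤ (z * + b)))
  (sym (from (fromℤ≡fromℤ*⇔ z (z * + b) (1/ b)) (sym (ℤₚ.*-identityʳ (z * + b)))))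

^-monoʳ-∣ : ∀ p {j k} → j ≤ k → p ^ j ∣ p ^ k
^-monoʳ-∣ p {k = k} z≤n = 1∣ (p ^ k)
^-monoʳ-∣ p (s≤s j≤k) = *-monoʳ-∣ p (^-monoʳ-∣ p j≤k)

^-∣-^⇔≤ : ∀ {p} → 1 < p → ∀ j k → p ^ j ∣ p ^ k ⇔ j ≤ k
^-∣-^⇔≤ {p@(suc _)} 1<p j k = mk⇔ to′ (^-monoʳ-∣ p)
  where
  to′ : p ^ j ∣ p ^ k → j ≤ k
  to′ pʲ∣pᵏ with j ≤? k
  ... | yes j≤k = j≤k
  ... | no j≰k = contradiction (∣⇒≤ {{ℕₚ.m^n≢0 p k}} pʲ∣pᵏ) (ℕₚ.<⇒≱ (ℕₚ.^-monoʳ-< p 1<p (ℕₚ.≰⇒> j≰k)))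

coprime-∣^⇒∣1 : ∀ {b p} → Coprime b p → ∀ k → b ∣ p ^ k → b ∣ 1
coprime-∣^⇒∣1 b⊥p zero b∣1 = b∣1
coprime-∣^⇒∣1 b⊥p (suc k) b∣pᵏ⁺¹ = coprime-∣^⇒∣1 b⊥p k (coprime-divisor b⊥p b∣pᵏ⁺¹)

-- b / gcd b p is coprime to p / gcd b p, so dividing b by the gcd costs exactly one factor p.
∣^suc⇔/gcd∣^ : ∀ b p k .{{_ : NonZero (gcd b p)}} → b ∣ p ^ suc k ⇔ b / gcd b p ∣ p ^ k
∣^suc⇔/gcd∣^ b p k = mk⇔ to′ from′
  where
  g : ℕ
  g = gcd b p
  to′ : b ∣ p ^ suc k → b / g ∣ p ^ k
  to′ b∣pᵏ⁺¹ = coprime-divisor (coprime-/gcd b p)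
    (m∣n*o⇒m/n∣o (gcd[m,n]∣m b p) (subst (b ∣_) p·pᵏ≡ b∣pᵏ⁺¹))
    where
    p·pᵏ≡ : p ℕ.* p ^ k ≡ p / g ℕ.* p ^ k ℕ.* g
    p·pᵏ≡ = begin
      p ℕ.* p ^ k             ≡⟨ cong (ℕ._* p ^ k) (sym (m/n*n≡m (gcd[m,n]∣n b p))) ⟩
      p / g ℕ.* g ℕ.* p ^ k   ≡⟨ ℕₚ.*-assoc (p / g) g (p ^ k) ⟩
      p / g ℕ.* (g ℕ.* p ^ k) ≡⟨ cong (p / g ℕ.*_) (ℕₚ.*-comm g (p ^ k)) ⟩
      p / g ℕ.* (p ^ k ℕ.* g) ≡⟨ sym (ℕₚ.*-assoc (p / g) (p ^ k) g) ⟩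
      p / g ℕ.* p ^ k ℕ.* g   ∎
      where open ≡-Reasoning
  from′ : b / g ∣ p ^ k → b ∣ p ^ suc k
  from′ b/g∣pᵏ = ∣-trans (m/n∣o⇒m∣o*n (gcd[m,n]∣m b p) b/g∣pᵏ)
    (subst (p ^ k ℕ.* g ∣_) (ℕₚ.*-comm (p ^ k) p) (*-monoʳ-∣ (p ^ k) (gcd[m,n]∣n b p)))

∃∣^? : ∀ b p .{{_ : NonZero b}} → Dec (∃[ k ] b ∣ p ^ k)
∃∣^? b p = descend b (<-wellFounded b)
  where
  descend : ∀ b .{{_ : NonZero b}} → Acc _<_ b → Dec (∃[ k ] b ∣ p ^ k)
  descend 1 _ = yes (0 , ∣-refl)
  descend b@(suc (suc _)) (acc smaller) with gcd b p ≟ 1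
  ... | yes g≡1 = no λ (k , b∣pᵏ) →
    contradiction (∣1⇒≡1 (coprime-∣^⇒∣1 (gcd≡1⇒coprime {b} {p} g≡1) k b∣pᵏ)) λ ()
  ... | no g≢1 = map′ lift lower
          (descend (b / gcd b p) {{ℕ.≢-nonZero (m/gcd[m,n]≢0 b p)}}
            (smaller (m/n<m b (gcd b p) (>1 (gcd b p) g≢1))))
    where
    instance
      g≢0 : NonZero (gcd b p)
      g≢0 = ℕ.≢-nonZero (gcd[m,n]≢0 b p (inj₁ λ ()))
    lift : ∃[ k ] b / gcd b p ∣ p ^ k → ∃[ k ] b ∣ p ^ k
    lift (k , b/g∣pᵏ) = suc k , from (∣^suc⇔/gcd∣^ b p k) b/g∣pᵏ
    lower : ∃[ k ] b ∣ p ^ k → ∃[ k ] b / gcd b p ∣ p ^ k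
    lower (zero , b∣1) = contradiction (∣1⇒≡1 b∣1) λ ()
    lower (suc k , b∣pᵏ⁺¹) = k , to (∣^suc⇔/gcd∣^ b p k) b∣pᵏ⁺¹
    >1 : ∀ n .{{_ : NonZero n}} → n ≢ 1 → 1 < n
    >1 (suc zero) n≢1 = contradiction refl n≢1
    >1 (suc (suc n)) _ = s≤s (s≤s z≤n)

upward-closed-threshold : ∀ {T : ℕ → Set} → Decidable T → (∀ {j k} → j ≤ k → T j → T k) →
            ∀ {k} → T k → Σ ℕ λ k₀ → T ≐ (k₀ ≤_)
upward-closed-threshold T? up {zero} t = 0 , λ j → mk⇔ (λ _ → z≤n) (λ _ → up z≤n t)
upward-closed-threshold T? up {suc k} t with T? k
... | yes tₖ = upward-closed-threshold T? up tₖ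
... | no ¬tₖ = suc k , λ j → mk⇔ (λ tⱼ → ℕₚ.≰⇒> (λ j≤k → ¬tₖ (up j≤k tⱼ))) (λ k<j → up k<j t)

∣^-dichotomy : ∀ b p .{{_ : NonZero b}} →
               (∀ k → b ∤ p ^ k) ⊎ Σ ℕ λ k₀ → (λ k → b ∣ p ^ k) ≐ (k₀ ≤_)
∣^-dichotomy b p with ∃∣^? b p
... | no ∄ = inj₁ λ k b∣pᵏ → ∄ (k , b∣pᵏ)
... | yes (k , b∣pᵏ) = inj₂ (upward-closed-threshold {T = λ j → b ∣ p ^ j} (λ j → b ∣? p ^ j)
                          (λ i≤j b∣pⁱ → ∣-trans b∣pⁱ (^-monoʳ-∣ p i≤j)) {k} b∣pᵏ)

shift : SubsetN → SubsetN
shift T zero = ⊤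
shift T (suc k) = T k

shift-∅ : ∀ {T} → (∀ k → ¬ T k) → shift T ≐ Zero
shift-∅ ¬T zero = mk⇔ (λ _ → refl) (λ _ → tt)
shift-∅ ¬T (suc k) = mk⇔ (⊥-elim ∘ ¬T k) λ ()

shift-≥ : ∀ {T k₀} → T ≐ (k₀ ≤_) → shift T ≐ Sₘ (suc k₀)
shift-≥ T≐ zero = mk⇔ (λ _ → inj₁ refl) (λ _ → tt)
shift-≥ T≐ (suc k) = mk⇔ (inj₂ ∘ s≤s ∘ to (T≐ k)) λ { (inj₁ ()) ; (inj₂ (s≤s k₀≤k)) → from (T≐ k) k₀≤k }

Even : SubsetN
Even n = Σ ℕ λ i → n ≡ i ℕ.* 2

data Parity : ℕ → Set where
  even : ∀ j → Parity (j ℕ.* 2)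
  odd  : ∀ j → Parity (suc (j ℕ.* 2))

parity : ∀ n → Parity n
parity zero = even 0
parity (suc n) with parity n
... | even j = odd j
... | odd j = even (suc j)

odd≢even : ∀ j i → suc (j ℕ.* 2) ≢ i ℕ.* 2
odd≢even zero (suc i) ()
odd≢even (suc j) (suc i) e = odd≢even j i (ℕₚ.suc-injective (ℕₚ.suc-injective e))

≐-by-parity : ∀ {S T} → (∀ j → S (j ℕ.* 2) ⇔ T (j ℕ.* 2)) →
              (∀ j → S (suc (j ℕ.* 2)) ⇔ T (suc (j ℕ.* 2))) → S ≐ T
≐-by-parity evens odds n with parity n
... | even j = evens j
... | odd j = odds j

evenOr : SubsetN → SubsetN
evenOr T n = Even n ⊎ Σ ℕ λ j → n ≡ suc (j ℕ.* 2) × T j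

evenOr-odd : ∀ T j → evenOr T (suc (j ℕ.* 2)) ⇔ T j
evenOr-odd T j = mk⇔ to′ (λ t → inj₂ (j , refl , t))
  where
  to′ : evenOr T (suc (j ℕ.* 2)) → T j
  to′ (inj₁ (i , e)) = ⊥-elim (odd≢even j i e)
  to′ (inj₂ (i , e , t)) = subst T (ℕₚ.*-cancelʳ-≡ i j 2 (ℕₚ.suc-injective (sym e))) t

evens∈⟨⟩ : ∀ {gs} → 2 ∈ gs → ∀ j → ⟨ gs ⟩ (j ℕ.* 2)
evens∈⟨⟩ 2∈gs zero = gen-zero
evens∈⟨⟩ 2∈gs (suc j) = gen-add 2∈gs (evens∈⟨⟩ 2∈gs j)

⟨2⟩⊆Even : ∀ {n} → ⟨ 2 ∷ [] ⟩ n → Even n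
⟨2⟩⊆Even gen-zero = 0 , refl
⟨2⟩⊆Even (gen-add (here refl) x) with ⟨2⟩⊆Even x
... | i , refl = suc i , refl

⟨2,m⟩⊆Even∪≥m : ∀ {m n} → ⟨ 2 ∷ m ∷ [] ⟩ n → Even n ⊎ m ≤ n
⟨2,m⟩⊆Even∪≥m gen-zero = inj₁ (0 , refl)
⟨2,m⟩⊆Even∪≥m (gen-add (here refl) x) with ⟨2,m⟩⊆Even∪≥m x
... | inj₁ (i , refl) = inj₁ (suc i , refl)
... | inj₂ m≤n = inj₂ (ℕₚ.m≤n⇒m≤o+n 2 m≤n)
⟨2,m⟩⊆Even∪≥m {m} (gen-add {n = n} (there (here refl)) x) = inj₂ (ℕₚ.m≤m+n m n)

⟨2,1+2k₀⟩-odd : ∀ k₀ j → ⟨ 2 ∷ suc (k₀ ℕ.* 2) ∷ [] ⟩ (suc (j ℕ.* 2)) ⇔ k₀ ≤ j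
⟨2,1+2k₀⟩-odd k₀ j = mk⇔ to′ from′
  where
  to′ : ⟨ 2 ∷ suc (k₀ ℕ.* 2) ∷ [] ⟩ (suc (j ℕ.* 2)) → k₀ ≤ j
  to′ x with ⟨2,m⟩⊆Even∪≥m x
  ... | inj₁ (i , e) = ⊥-elim (odd≢even j i e)
  ... | inj₂ (s≤s 2k₀≤2j) = ℕₚ.*-cancelʳ-≤ k₀ j 2 2k₀≤2j
  from′ : k₀ ≤ j → ⟨ 2 ∷ suc (k₀ ℕ.* 2) ∷ [] ⟩ (suc (j ℕ.* 2))
  from′ k₀≤j = subst (λ n → ⟨ 2 ∷ suc (k₀ ℕ.* 2) ∷ [] ⟩ (suc n))
    (trans (sym (ℕₚ.*-distribʳ-+ 2 k₀ (j ℕ.∸ k₀))) (cong (ℕ._* 2) (ℕₚ.m+[n∸m]≡n k₀≤j)))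
    (gen-add (there (here refl)) (evens∈⟨⟩ (here refl) (j ℕ.∸ k₀)))

evenOr-∅ : ∀ {T} → (∀ k → ¬ T k) → evenOr T ≐ ⟨ 2 ∷ [] ⟩
evenOr-∅ {T} ¬T = ≐-by-parity
  (λ j → mk⇔ (λ _ → evens∈⟨⟩ (here refl) j) (λ _ → inj₁ (j , refl)))
  (λ j → mk⇔ (⊥-elim ∘ ¬T j ∘ to (evenOr-odd T j))
             (λ x → let i , e = ⟨2⟩⊆Even x in ⊥-elim (odd≢even j i e)))

evenOr-≥ : ∀ {T k₀} → T ≐ (k₀ ≤_) → evenOr T ≐ ⟨ 2 ∷ suc (k₀ ℕ.* 2) ∷ [] ⟩
evenOr-≥ {T} {k₀} T≐ = ≐-by-parity
  (λ j → mk⇔ (λ _ → evens∈⟨⟩ (here refl) j) (λ _ → inj₁ (j , refl)))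
  (λ j → ⇔-trans (evenOr-odd T j) (⇔-trans (T≐ j) (⇔-sym (⟨2,1+2k₀⟩-odd k₀ j))))

U-Q≡0 : ∀ P k → U P (+ 0) (suc k) ≡ P ℤ.^ k
U-Q≡0 P zero = refl
U-Q≡0 P (suc k) = trans (ℤₚ.+-identityʳ (P * U P (+ 0) (suc k))) (cong (P *_) (U-Q≡0 P k))

U-P≡0-step : ∀ Q n → U (+ 0) Q (suc (suc n)) ≡ - Q * U (+ 0) Q n
U-P≡0-step Q n = trans (ℤₚ.+-identityˡ _) (ℤₚ.neg-distribˡ-* Q (U (+ 0) Q n))

U-P≡0-even : ∀ Q j → U (+ 0) Q (j ℕ.* 2) ≡ + 0
U-P≡0-even Q zero = refl
U-P≡0-even Q (suc j) = trans (U-P≡0-step Q (j ℕ.* 2))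
  (trans (cong (- Q *_) (U-P≡0-even Q j)) (ℤₚ.*-zeroʳ (- Q)))

U-P≡0-odd : ∀ Q j → U (+ 0) Q (suc (j ℕ.* 2)) ≡ (- Q) ℤ.^ j
U-P≡0-odd Q zero = refl
U-P≡0-odd Q (suc j) = trans (U-P≡0-step Q (suc (j ℕ.* 2))) (cong (- Q *_) (U-P≡0-odd Q j))

∣^∣ : ∀ z k → ℤ.∣ z ℤ.^ k ∣ ≡ ℤ.∣ z ∣ ^ k
∣^∣ z zero = refl
∣^∣ z (suc k) = trans (ℤₚ.abs-* z (z ℤ.^ k)) (cong (ℤ.∣ z ∣ ℕ.*_) (∣^∣ z k))

𝓛⇔IsInt : ∀ P Q R n {z} → U P Q n ≡ z → 𝓛 P Q R n ⇔ IsInt (fromℤ z ℚ.* R)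
𝓛⇔IsInt P Q R n refl = ⇔-refl

U≡0⇒𝓛 : ∀ P Q R n → U P Q n ≡ + 0 → 𝓛 P Q R n
U≡0⇒𝓛 P Q R n U≡0 = from (⇔-trans (𝓛⇔IsInt P Q R n U≡0) (IsInt-fromℤ*⇔ (+ 0) R)) (↧ₙ R ∣0)

𝓛⇔↧∣^ : ∀ P Q R n z k → U P Q n ≡ z ℤ.^ k → 𝓛 P Q R n ⇔ ↧ₙ R ∣ ℤ.∣ z ∣ ^ k
𝓛⇔↧∣^ P Q R n z k U≡zᵏ = ⇔-trans (𝓛⇔IsInt P Q R n U≡zᵏ)
  (subst (λ m → IsInt (fromℤ (z ℤ.^ k) ℚ.* R) ⇔ ↧ₙ R ∣ m) (∣^∣ z k) (IsInt-fromℤ*⇔ (z ℤ.^ k) R))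

𝓛-Q≡0 : ∀ P R → 𝓛 P (+ 0) R ≐ shift (λ k → ↧ₙ R ∣ ℤ.∣ P ∣ ^ k)
𝓛-Q≡0 P R zero = mk⇔ (λ _ → tt) (λ _ → U≡0⇒𝓛 P (+ 0) R 0 refl)
𝓛-Q≡0 P R (suc k) = 𝓛⇔↧∣^ P (+ 0) R (suc k) P k (U-Q≡0 P k)

𝓛-P≡0 : ∀ Q R → 𝓛 (+ 0) Q R ≐ evenOr (λ j → ↧ₙ R ∣ ℤ.∣ Q ∣ ^ j)
𝓛-P≡0 Q R = ≐-by-parity
  (λ j → mk⇔ (λ _ → inj₁ (j , refl)) (λ _ → U≡0⇒𝓛 (+ 0) Q R (j ℕ.* 2) (U-P≡0-even Q j)))
  (λ j → ⇔-trans (subst (λ m → 𝓛 (+ 0) Q R (suc (j ℕ.* 2)) ⇔ ↧ₙ R ∣ m ^ j) (ℤₚ.∣-i∣≡∣i∣ Q)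
                          (𝓛⇔↧∣^ (+ 0) Q R (suc (j ℕ.* 2)) (- Q) j (U-P≡0-odd Q j)))
                 (⇔-sym (evenOr-odd _ j)))

sumFin-scale : ∀ d c {f g : Fin d → ℚ} → (∀ k → f k ≡ c ℚ.* g k) → sumFin d f ≡ c ℚ.* sumFin d g
sumFin-scale zero c _ = sym (ℚₚ.*-zeroʳ c)
sumFin-scale (suc d) c {f} {g} f≡cg =
  trans (cong₂ ℚ._+_ (f≡cg zero) (sumFin-scale d c (f≡cg ∘ suc)))
        (sym (ℚₚ.*-distribˡ-+ c (g zero) (sumFin d (g ∘ suc))))

sumFin-idMat : ∀ d (f : Fin d → ℚ) j → sumFin d (λ k → f k ℚ.* idMat d k j) ≡ f j
sumFin-idMat (suc d) f zero = begin
  f zero ℚ.* 1ℚ ℚ.+ sumFin d (λ k → f (suc k) ℚ.* 0ℚ)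
    ≡⟨ cong₂ ℚ._+_ (ℚₚ.*-identityʳ (f zero)) (sumFin-scale d 0ℚ (λ k → ℚₚ.*-comm (f (suc k)) 0ℚ)) ⟩
  f zero ℚ.+ 0ℚ ℚ.* sumFin d (f ∘ suc)
    ≡⟨ cong (f zero ℚ.+_) (ℚₚ.*-zeroˡ (sumFin d (f ∘ suc))) ⟩
  f zero ℚ.+ 0ℚ
    ≡⟨ ℚₚ.+-identityʳ (f zero) ⟩
  f zero ∎
  where open ≡-Reasoning
sumFin-idMat (suc d) f (suc j) =
  trans (cong₂ ℚ._+_ (ℚₚ.*-zeroʳ (f zero)) (sumFin-idMat d (f ∘ suc) j)) (ℚₚ.+-identityˡ (f (suc j)))

⊛-identityʳ : ∀ {d} (A : Mat d) i j → (A ⊛ idMat d) i j ≡ A i j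
⊛-identityʳ {d} A i j = sumFin-idMat d (A i) j

⊛-scaleʳ : ∀ {d} (A M N : Mat d) c → (∀ k j → M k j ≡ c ℚ.* N k j) →
           ∀ i j → (A ⊛ M) i j ≡ c ℚ.* (A ⊛ N) i j
⊛-scaleʳ {d} A M N c M≡cN i j =
  sumFin-scale d c (λ k → trans (cong (A i k ℚ.*_) (M≡cN k j)) (x∙yz≈y∙xz (A i k) c (N k j)))

^ᴹ-suc-of-square : ∀ {d} (A : Mat d) C → (∀ i j → (A ⊛ A) i j ≡ fromℤ C ℚ.* A i j) →
                   ∀ k i j → (A ^ᴹ suc k) i j ≡ fromℤ (C ℤ.^ k) ℚ.* A i j
^ᴹ-suc-of-square A C A²≡CA zero i j = trans (⊛-identityʳ A i j) (sym (ℚₚ.*-identityˡ (A i j)))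
^ᴹ-suc-of-square A C A²≡CA (suc k) i j = begin
  (A ⊛ (A ^ᴹ suc k)) i j
    ≡⟨ ⊛-scaleʳ A (A ^ᴹ suc k) A (fromℤ (C ℤ.^ k)) (^ᴹ-suc-of-square A C A²≡CA k) i j ⟩
  fromℤ (C ℤ.^ k) ℚ.* (A ⊛ A) i j             ≡⟨ cong (fromℤ (C ℤ.^ k) ℚ.*_) (A²≡CA i j) ⟩
  fromℤ (C ℤ.^ k) ℚ.* (fromℤ C ℚ.* A i j)     ≡⟨ fromℤ-*-assoc (C ℤ.^ k) C (A i j) ⟩
  fromℤ (C ℤ.^ k * C) ℚ.* A i j               ≡⟨ cong (λ c → fromℤ c ℚ.* A i j) (ℤₚ.*-comm (C ℤ.^ k) C) ⟩
  fromℤ (C ℤ.^ suc k) ℚ.* A i j               ∎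
  where open ≡-Reasoning

^ᴹ-*2+-of-square : ∀ {d} (A : Mat d) C → (∀ M i j → (A ⊛ (A ⊛ M)) i j ≡ fromℤ C ℚ.* M i j) →
                   ∀ k n i j → (A ^ᴹ (k ℕ.* 2 ℕ.+ n)) i j ≡ fromℤ (C ℤ.^ k) ℚ.* (A ^ᴹ n) i j
^ᴹ-*2+-of-square A C A²≡C zero n i j = sym (ℚₚ.*-identityˡ ((A ^ᴹ n) i j))
^ᴹ-*2+-of-square A C A²≡C (suc k) n i j = begin
  (A ⊛ (A ⊛ (A ^ᴹ (k ℕ.* 2 ℕ.+ n)))) i j           ≡⟨ A²≡C (A ^ᴹ (k ℕ.* 2 ℕ.+ n)) i j ⟩
  fromℤ C ℚ.* (A ^ᴹ (k ℕ.* 2 ℕ.+ n)) i j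
    ≡⟨ cong (fromℤ C ℚ.*_) (^ᴹ-*2+-of-square A C A²≡C k n i j) ⟩
  fromℤ C ℚ.* (fromℤ (C ℤ.^ k) ℚ.* (A ^ᴹ n) i j)   ≡⟨ fromℤ-*-assoc C (C ℤ.^ k) ((A ^ᴹ n) i j) ⟩
  fromℤ (C ℤ.^ suc k) ℚ.* (A ^ᴹ n) i j             ∎
  where open ≡-Reasoning

rowMatrix : ℚ → ℚ → Mat 2
rowMatrix a b zero zero = a
rowMatrix a b zero (suc zero) = b
rowMatrix a b (suc zero) _ = 0ℚ

antidiagonal : ℚ → ℚ → Mat 2
antidiagonal x y zero zero = 0ℚ
antidiagonal x y zero (suc zero) = x
antidiagonal x y (suc zero) zero = y
antidiagonal x y (suc zero) (suc zero) = 0ℚ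

rowMatrix-square : ∀ a b i j → (rowMatrix a b ⊛ rowMatrix a b) i j ≡ a ℚ.* rowMatrix a b i j
rowMatrix-square a b zero zero =
  solve 2 (λ a b → a :* a :+ (b :* con 0ℚ :+ con 0ℚ) := a :* a) refl a b
  where open +-*-Solver
rowMatrix-square a b zero (suc zero) =
  solve 2 (λ a b → a :* b :+ (b :* con 0ℚ :+ con 0ℚ) := a :* b) refl a b
  where open +-*-Solver
rowMatrix-square a b (suc zero) j =
  solve 2 (λ a c → con 0ℚ :* c :+ (con 0ℚ :* con 0ℚ :+ con 0ℚ) := a :* con 0ℚ)
    refl a (rowMatrix a b zero j)
  where open +-*-Solver

antidiagonal-square : ∀ x y M i j → (antidiagonal x y ⊛ (antidiagonal x y ⊛ M)) i j ≡ (x ℚ.* y) ℚ.* M i j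
antidiagonal-square x y M zero j = solve 4 (λ x y u v →
  con 0ℚ :* (con 0ℚ :* u :+ (x :* v :+ con 0ℚ)) :+ (x :* (y :* u :+ (con 0ℚ :* v :+ con 0ℚ)) :+ con 0ℚ)
    := (x :* y) :* u) refl x y (M zero j) (M (suc zero) j)
  where open +-*-Solver
antidiagonal-square x y M (suc zero) j = solve 4 (λ x y u v →
  y :* (con 0ℚ :* u :+ (x :* v :+ con 0ℚ)) :+ (con 0ℚ :* (y :* u :+ (con 0ℚ :* v :+ con 0ℚ)) :+ con 0ℚ)
    := (x :* y) :* v) refl x y (M zero j) (M (suc zero) j)
  where open +-*-Solver

IsInt-cong : ∀ {x y} → x ≡ y → IsInt x ⇔ IsInt y
IsInt-cong refl = ⇔-refl

IsInt-0ℚ : IsInt 0ℚ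
IsInt-0ℚ = + 0 , refl

IsInt-idMat : ∀ i j → IsInt (idMat 2 i j)
IsInt-idMat zero zero = + 1 , refl
IsInt-idMat zero (suc zero) = IsInt-0ℚ
IsInt-idMat (suc zero) zero = IsInt-0ℚ
IsInt-idMat (suc zero) (suc zero) = + 1 , refl

IsIntMat⇔corner : ∀ {B : Mat 2} → IsInt (B zero zero) → IsInt (B (suc zero) zero) →
                  IsInt (B (suc zero) (suc zero)) → IsIntMat B ⇔ IsInt (B zero (suc zero))
IsIntMat⇔corner {B} b₀₀ b₁₀ b₁₁ = mk⇔ (λ int → int zero (suc zero)) entries
  where
  entries : IsInt (B zero (suc zero)) → IsIntMat B
  entries b₀₁ zero zero = b₀₀
  entries b₀₁ zero (suc zero) = b₀₁
  entries b₀₁ (suc zero) zero = b₁₀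
  entries b₀₁ (suc zero) (suc zero) = b₁₁

𝓢-rowMatrix : ∀ P R → 𝓢 (rowMatrix (fromℤ P) R) ≐ 𝓛 P (+ 0) R
𝓢-rowMatrix P R zero = mk⇔ (λ _ → U≡0⇒𝓛 P (+ 0) R 0 refl) (λ _ → IsInt-idMat)
𝓢-rowMatrix P R (suc k) =
  ⇔-trans (IsIntMat⇔corner (scaled zero zero (IsInt-fromℤ P)) (scaled (suc zero) zero IsInt-0ℚ)
                           (scaled (suc zero) (suc zero) IsInt-0ℚ))
          (⇔-trans (IsInt-cong (Aᵏ⁺¹ zero (suc zero))) (⇔-sym (𝓛⇔IsInt P (+ 0) R (suc k) (U-Q≡0 P k))))
  where
  A : Mat 2
  A = rowMatrix (fromℤ P) R
  Aᵏ⁺¹ : ∀ i j → (A ^ᴹ suc k) i j ≡ fromℤ (P ℤ.^ k) ℚ.* A i j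
  Aᵏ⁺¹ = ^ᴹ-suc-of-square A P (rowMatrix-square (fromℤ P) R) k
  scaled : ∀ i j → IsInt (A i j) → IsInt ((A ^ᴹ suc k) i j)
  scaled i j int = from (IsInt-cong (Aᵏ⁺¹ i j)) (IsInt-fromℤ* (P ℤ.^ k) int)

𝓢-antidiagonal : ∀ Q R Y → R ℚ.* fromℤ Y ≡ fromℤ (- Q) → 𝓢 (antidiagonal R (fromℤ Y)) ≐ 𝓛 (+ 0) Q R
𝓢-antidiagonal Q R Y RY≡-Q = ≐-by-parity
  (λ j → mk⇔ (λ _ → U≡0⇒𝓛 (+ 0) Q R (j ℕ.* 2) (U-P≡0-even Q j))
             (λ _ i k → from (IsInt-cong (A²ʲ j i k)) (IsInt-fromℤ* ((- Q) ℤ.^ j) (IsInt-idMat i k))))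
  (λ j → ⇔-trans (IsIntMat⇔corner (scaled j zero zero IsInt-0ℚ)
                                  (scaled j (suc zero) zero (IsInt-fromℤ Y))
                                  (scaled j (suc zero) (suc zero) IsInt-0ℚ))
                 (⇔-trans (IsInt-cong (A²ʲ⁺¹ j zero (suc zero)))
                          (⇔-sym (𝓛⇔IsInt (+ 0) Q R (suc (j ℕ.* 2)) (U-P≡0-odd Q j)))))
  where
  A : Mat 2
  A = antidiagonal R (fromℤ Y)
  A²≡-Q : ∀ M i j → (A ⊛ (A ⊛ M)) i j ≡ fromℤ (- Q) ℚ.* M i j
  A²≡-Q M i j = trans (antidiagonal-square R (fromℤ Y) M i j) (cong (ℚ._* M i j) RY≡-Q)
  A²ʲ : ∀ j i k → (A ^ᴹ (j ℕ.* 2)) i k ≡ fromℤ ((- Q) ℤ.^ j) ℚ.* idMat 2 i k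
  A²ʲ j i k = trans (cong (λ m → (A ^ᴹ m) i k) (sym (ℕₚ.+-identityʳ (j ℕ.* 2))))
                    (^ᴹ-*2+-of-square A (- Q) A²≡-Q j 0 i k)
  A²ʲ⁺¹ : ∀ j i k → (A ^ᴹ suc (j ℕ.* 2)) i k ≡ fromℤ ((- Q) ℤ.^ j) ℚ.* A i k
  A²ʲ⁺¹ j i k = trans (cong (λ m → (A ^ᴹ m) i k) (ℕₚ.+-comm 1 (j ℕ.* 2)))
                (trans (^ᴹ-*2+-of-square A (- Q) A²≡-Q j 1 i k)
                       (cong (fromℤ ((- Q) ℤ.^ j) ℚ.*_) (⊛-identityʳ A i k)))
  scaled : ∀ j i k → IsInt (A i k) → IsInt ((A ^ᴹ suc (j ℕ.* 2)) i k)
  scaled j i k int = from (IsInt-cong (A²ʲ⁺¹ j i k)) (IsInt-fromℤ* ((- Q) ℤ.^ j) int)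

threshold-pos : ∀ {R p k₀} → ¬ IsInt R → (λ k → ↧ₙ R ∣ p ^ k) ≐ (k₀ ≤_) → 0 < k₀
threshold-pos {R} {k₀ = zero} R∉ℤ T≐ = contradiction (from (IsInt⇔↧∣1 R) (from (T≐ 0) z≤n)) R∉ℤ
threshold-pos {k₀ = suc _} _ _ = s≤s z≤n

classification : (P Q : ℤ) (R : ℚ) → P * Q ≡ + 0 → ¬ IsInt R → InList (𝓛 P Q R)
classification P Q R PQ≡0 R∉ℤ with ℤₚ.i*j≡0⇒i≡0∨j≡0 P PQ≡0
... | inj₂ refl with ∣^-dichotomy (↧ₙ R) ℤ.∣ P ∣
...   | inj₁ never = inj₁ (≐-trans (𝓛-Q≡0 P R) (shift-∅ never))
...   | inj₂ (k₀ , T≐) =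
        inj₂ (inj₁ (suc k₀ , s≤s (threshold-pos R∉ℤ T≐) , ≐-trans (𝓛-Q≡0 P R) (shift-≥ T≐)))
classification P Q R PQ≡0 R∉ℤ | inj₁ refl with ∣^-dichotomy (↧ₙ R) ℤ.∣ Q ∣
...   | inj₁ never = inj₂ (inj₂ (inj₁ (≐-trans (𝓛-P≡0 Q R) (evenOr-∅ never))))
...   | inj₂ (k₀ , T≐) = inj₂ (inj₂ (inj₂
        (suc (k₀ ℕ.* 2) , (k₀ , cong suc (ℕₚ.*-comm k₀ 2)) ,
         s≤s (ℕₚ.*-monoˡ-≤ 2 (threshold-pos R∉ℤ T≐)) , ≐-trans (𝓛-P≡0 Q R) (evenOr-≥ T≐))))

LucasRealizable : SubsetN → Set
LucasRealizable S = Σ ℤ λ P → Σ ℤ λ Q → Σ ℚ λ R → P * Q ≡ + 0 × ¬ IsInt R × 𝓛 P Q R ≐ S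

realize-Q≡0 : ∀ {S} P R → ¬ IsInt R → 𝓛 P (+ 0) R ≐ S → LucasRealizable S × Realizable 2 S
realize-Q≡0 P R R∉ℤ 𝓛≐S =
  (P , + 0 , R , ℤₚ.*-zeroʳ P , R∉ℤ , 𝓛≐S) , rowMatrix (fromℤ P) R , ≐-trans (𝓢-rowMatrix P R) 𝓛≐S

realize-P≡0 : ∀ {S} Q b .{{_ : NonZero b}} → ¬ IsInt (1/ b) → 𝓛 (+ 0) Q (1/ b) ≐ S →
              LucasRealizable S × Realizable 2 S
realize-P≡0 Q b R∉ℤ 𝓛≐S =
  (+ 0 , Q , 1/ b , refl , R∉ℤ , 𝓛≐S) ,
  antidiagonal (1/ b) (fromℤ (- Q * + b)) ,
  ≐-trans (𝓢-antidiagonal Q (1/ b) (- Q * + b) (1/-*-fromℤ b (- Q))) 𝓛≐S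

2∤1^ : ∀ k → 2 ∤ 1 ^ k
2∤1^ k 2∣1ᵏ = contradiction (∣1⇒≡1 (subst (2 ∣_) (ℕₚ.^-zeroˡ k) 2∣1ᵏ)) λ ()

1/2-∉ℤ : ¬ IsInt (1/ 2)
1/2-∉ℤ = 2∤1^ 0 ∘ to (IsInt⇔↧∣1 (1/ 2))

1/2^-threshold : ∀ k₀ .{{_ : NonZero (2 ^ k₀)}} → (λ k → ↧ₙ (1/ (2 ^ k₀)) ∣ 2 ^ k) ≐ (k₀ ≤_)
1/2^-threshold k₀ k =
  subst (λ b → (b ∣ 2 ^ k) ⇔ k₀ ≤ k) (sym (↧ₙ-1/ (2 ^ k₀))) (^-∣-^⇔≤ (s≤s (s≤s z≤n)) k₀ k)

1/2^-∉ℤ : ∀ k₀ .{{_ : NonZero (2 ^ k₀)}} → 0 < k₀ → ¬ IsInt (1/ (2 ^ k₀))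
1/2^-∉ℤ k₀ 0<k₀ R∈ℤ = ℕₚ.<⇒≱ 0<k₀ (to (1/2^-threshold k₀ 0) (to (IsInt⇔↧∣1 (1/ (2 ^ k₀))) R∈ℤ))

realization : (S : SubsetN) → InList S → LucasRealizable S × Realizable 2 S
realization S (inj₁ S≐0) =
  realize-Q≡0 (+ 1) (1/ 2) 1/2-∉ℤ (≐-trans (≐-trans (𝓛-Q≡0 (+ 1) (1/ 2)) (shift-∅ 2∤1^)) (≐-sym S≐0))
realization S (inj₂ (inj₁ (suc k₀ , s≤s 0<k₀ , S≐Sₘ))) =
  realize-Q≡0 (+ 2) (1/ (2 ^ k₀)) (1/2^-∉ℤ k₀ 0<k₀)
    (≐-trans (≐-trans (𝓛-Q≡0 (+ 2) (1/ (2 ^ k₀))) (shift-≥ (1/2^-threshold k₀))) (≐-sym S≐Sₘ))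
  where
  instance
    2^k₀≢0 : NonZero (2 ^ k₀)
    2^k₀≢0 = ℕₚ.m^n≢0 2 k₀
realization S (inj₂ (inj₂ (inj₁ S≐⟨2⟩))) =
  realize-P≡0 (+ 1) 2 1/2-∉ℤ (≐-trans (≐-trans (𝓛-P≡0 (+ 1) (1/ 2)) (evenOr-∅ 2∤1^)) (≐-sym S≐⟨2⟩))
realization S (inj₂ (inj₂ (inj₂ (.(suc (2 ℕ.* k₀)) , (k₀ , refl) , s≤s 2≤2k₀ , S≐⟨2,m⟩)))) =
  realize-P≡0 (+ 2) (2 ^ k₀) (1/2^-∉ℤ k₀ 0<k₀)
    (≐-trans (≐-trans (𝓛-P≡0 (+ 2) (1/ (2 ^ k₀))) (evenOr-≥ (1/2^-threshold k₀)))
             (≐-sym (subst (λ m → S ≐ ⟨ 2 ∷ suc m ∷ [] ⟩) (ℕₚ.*-comm 2 k₀) S≐⟨2,m⟩)))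
  where
  instance
    2^k₀≢0 : NonZero (2 ^ k₀)
    2^k₀≢0 = ℕₚ.m^n≢0 2 k₀
  0<k₀ : 0 < k₀
  0<k₀ = ℕₚ.*-cancelˡ-≤ 2 2≤2k₀

corollary3p2 :
    ((P Q : ℤ) (R : ℚ) → P * Q ≡ + 0 → ¬ IsInt R → InList (𝓛 P Q R))
    × ((S : SubsetN) → InList S →
        (Σ ℤ λ P → Σ ℤ λ Q → Σ ℚ λ R →
           P * Q ≡ + 0 × ¬ IsInt R × 𝓛 P Q R ≐ S)
        × Realizable 2 S)
corollary3p2 = classification , realization
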